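{- Let $N,d$ be integers and let $\mathcal P,\mathcal P'$ be finite multisets of $(N,d)$-strict pairs. If $L_{\mathcal P}(z_{w,k}=D_{\bullet_{w,k}})=L_{\mathcal P'}(z_{w,k}=D_{\bullet_{w,k}})$, then $\mathcal P=\mathcal P'$. That is, $\mathcal P$ can be reconstructed from $L_{\mathcal P}(z_{w,k}=D_{\bullet_{w,k}})$.
   Context: A mark $(w,k)$ is a pair of integers with $w\ge1,k\ge0,w\ge k+1$; it is strict if $w>k+1$. An $(N,d)$-strict pair is an ordered pair of strict marks $((w_1,k_1),(w_2,k_2))$ with $w_1+w_2=N$, $k_1+k_2+1=d$, and either $w_1>w_2$, or $w_1=w_2$ and $k_1\le k_2$. For a multiset $\mathcal P$ of such pairs, $L_{\mathcal P}(\mathbf z)=\sum_{((w_1,k_1),(w_2,k_2))\in\mathcal P}z_{w_1,k_1}z_{w_2,k_2}$ (with multiplicity), in commuting indeterminates $z_{w,k}$. $D_{\bullet_{w,k}}=\sum_{i=0}^k(-1)^i\binom ki z_{w-i,0}z_{1,0}^i$, and $L_{\mathcal P}(z_{w,k}=D_{\bullet_{w,k}})$ denotes the result of replacing each $z_{w,k}$ by $D_{\bullet_{w,k}}$. -}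

module Defs where

open import Data.Nat as ℕ using (ℕ; zero; suc; _≤_; _<_; _∸_)
open import Data.Nat.Combinatorics using (_C_)
open import Data.Integer as ℤ using (ℤ; +_; -_)
open import Data.Bool using (Bool; true; false; _∧_; if_then_else_)
open import Data.Product using (_×_; _,_; proj₁; proj₂)
open import Data.Product.Properties using (≡-dec)
open import Data.Sum using (_⊎_)
open import Data.List using (List; []; _∷_; _++_; map; concatMap; foldr; upTo)
open import Relation.Binary.PropositionalEquality using (_≡_)
open import Relation.Nullary.Decidable using (⌊_⌋)

Mark : Set
Mark = ℕ × ℕ

IsMark : Mark → Set
IsMark (w , k) = (1 ≤ w) × (suc k ≤ w)

IsStrictMark : Mark → Set
IsStrictMark (w , k) = IsMark (w , k) × (suc k < w)

Pair : Set
Pair = Mark × Mark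

IsStrictPair : ℕ → ℕ → Pair → Set
IsStrictPair N d ((w₁ , k₁) , (w₂ , k₂)) =
  IsStrictMark (w₁ , k₁) × IsStrictMark (w₂ , k₂) ×
  (w₁ ℕ.+ w₂ ≡ N) × (k₁ ℕ.+ k₂ ℕ.+ 1 ≡ d) ×
  ((w₂ < w₁) ⊎ ((w₁ ≡ w₂) × (k₁ ≤ k₂)))

-- Polynomials with integer coefficients in commuting indeterminates
-- z_{w,k}, indexed by Var = ℕ × ℕ.
-- A monomial is a list of variables, considered up to reordering
-- (i.e. as a multiset). A polynomial is a formal sum of terms
-- (coefficient , monomial); two polynomials are equal iff every
-- monomial has the same total coefficient.

Var : Set
Var = ℕ × ℕ

Monomial : Set
Monomial = List Var

Poly : Set
Poly = List (ℤ × Monomial)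

_≟v_ = ≡-dec ℕ._≟_ ℕ._≟_

countVar : Var → Monomial → ℕ
countVar v [] = 0
countVar v (u ∷ m) = if ⌊ v ≟v u ⌋ then suc (countVar v m) else countVar v m

allB : (Var → Bool) → Monomial → Bool
allB f [] = true
allB f (v ∷ m) = f v ∧ allB f m

sameMonomial : Monomial → Monomial → Bool
sameMonomial m m' =
  allB (λ v → ⌊ countVar v m ℕ.≟ countVar v m' ⌋) (m ++ m')

coeff : Poly → Monomial → ℤ
coeff p m = foldr (λ t acc → (if sameMonomial (proj₂ t) m then proj₁ t else + 0) ℤ.+ acc) (+ 0) p

_≈P_ : Poly → Poly → Set
p ≈P q = ∀ m → coeff p m ≡ coeff q m

0P : Poly
0P = []

1P : Poly
1P = (+ 1 , []) ∷ []

var : Var → Poly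
var v = (+ 1 , v ∷ []) ∷ []

const : ℤ → Poly
const c = (c , []) ∷ []

_+P_ : Poly → Poly → Poly
p +P q = p ++ q

_*P_ : Poly → Poly → Poly
p *P q = concatMap (λ s → map (λ t → (proj₁ s ℤ.* proj₁ t , proj₂ s ++ proj₂ t)) q) p

sumP : List Poly → Poly
sumP = foldr _+P_ 0P

powP : Poly → ℕ → Poly
powP p zero = 1P
powP p (suc n) = p *P powP p n

substP : (Var → Poly) → Poly → Poly
substP σ p = sumP (map (λ t → const (proj₁ t) *P foldr (λ v acc → σ v *P acc) 1P (proj₂ t)) p)

L : List Pair → Poly
L P = sumP (map (λ pr → var (proj₁ pr) *P var (proj₂ pr)) P)

sign : ℕ → ℤ
sign zero = + 1
sign (suc i) = - sign i

D• : Var → Poly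
D• (w , k) =
  sumP (map (λ i → const (sign i ℤ.* (+ (k C i))) *P (var (w ∸ i , 0) *P powP (var (1 , 0)) i))
            (upTo (suc k)))

module Submission where

-- The expansion of D•(w₁,k₁) D•(w₂,k₂) is
--   Σ_{i ≤ k₁, j ≤ k₂} (-1)^(i+j) C(k₁,i) C(k₂,j) z_{w₁-i,0} z_{w₂-j,0} z_{1,0}^(i+j),
-- and strictness keeps w₁ - i and w₂ - j at least 2, so the exponent of z_{1,0} is i + j.
-- Give μ = ((W₁,K₁),(W₂,K₂)) the leading monomial z_{W₁,0} z_{W₂-K₂,0} z_{1,0}^K₂. It occurs
-- in the expansion of an (N,d)-strict pair π only if π ⊒ μ, where ⊒ compares first weights
-- and then, reversed, the values w₂ - k₂; and in the expansion of μ itself every occurrence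
-- has the sign (-1)^K₂, so its coefficient there is nonzero. The system is thus triangular:
-- for a ⊒-maximal μ in P ++ P′, the coefficient of its leading monomial is its multiplicity
-- times a nonzero constant, so μ occurs equally often in P and P′; remove it and recurse.

open import Defs
import Data.Nat as ℕ
open import Data.Nat using (ℕ; zero; suc; _+_; _∸_; _≤_; _<_; z≤n; s≤s; z<s)
import Data.Nat.Properties as ℕₚ
open import Data.Nat.Combinatorics using (_C_; nCn≡1)
open import Data.Nat.ListAction using (sum)
open import Data.Integer as ℤ using (ℤ; +_; -_; 0ℤ)
import Data.Integer.Properties as ℤₚ
open import Data.Bool using (true; false; if_then_else_; T)
open import Data.Bool.Properties using (T-∧)
open import Data.Product using (∃-syntax; _×_; _,_; proj₁; proj₂)
open import Data.Product.Properties using (≡-dec)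
open import Data.Sum using (_⊎_; inj₁; inj₂; [_,_])
import Data.Sum
open import Data.List using (List; []; _∷_; _++_; map; foldr; upTo; replicate; length)
import Data.List.Properties as Listₚ
open import Data.List.Membership.Propositional using (_∈_)
open import Data.List.Membership.Propositional.Properties using (∈-++⁺ˡ; ∈-++⁺ʳ; ∈-++⁻; ∈-upTo⁺; ∈-∃++)
open import Data.List.Relation.Unary.Any using (here; there)
open import Data.List.Relation.Unary.All as All using (All; []; _∷_)
open import Data.List.Relation.Unary.All.Properties using (all-upTo; ++⁺; ++⁻ˡ; ++⁻ʳ; replicate⁺)
open import Data.List.Relation.Binary.Permutation.Propositional
  using (_↭_; ↭-refl; ↭-prep; ↭-sym; ↭-trans)
import Data.List.Relation.Binary.Permutation.Propositional as ↭
open import Data.List.Relation.Binary.Permutation.Propositional.Properties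
  using (shift; All-resp-↭; ↭-length)
open import Function using (_∘_)
open import Function.Bundles using (Equivalence)
open import Level using (0ℓ)
open import Relation.Binary using (Rel; Transitive; Total; Decidable; DecidableEquality; tri<; tri≈; tri>)
open import Relation.Binary.PropositionalEquality
  using (_≡_; _≢_; refl; sym; cong; cong₂; subst; module ≡-Reasoning)
  renaming (trans to ≡-trans)
open import Relation.Nullary using (¬_; yes; no; contradiction)
open import Relation.Nullary.Decidable using (toWitness; fromWitness; T?)
open import Algebra.Properties.AbelianGroup ℤₚ.+-0-abelianGroup using (∙-cancelˡ)
import Algebra.Properties.CommutativeSemigroup as CommSemigroupₚ

∑ : {X : Set} → List X → (X → ℤ) → ℤ
∑ xs g = foldr (λ x s → g x ℤ.+ s) 0ℤ xs

syntax ∑ xs (λ x → e) = ∑[ x ∈ xs ] e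

∑-↭ : {X : Set} {xs ys : List X} (g : X → ℤ) → xs ↭ ys → ∑ xs g ≡ ∑ ys g
∑-↭ g ↭.refl = refl
∑-↭ g (↭.prep x p) = cong (λ s → g x ℤ.+ s) (∑-↭ g p)
∑-↭ g (↭.swap {xs} x y p) =
  ≡-trans (CommSemigroupₚ.x∙yz≈y∙xz ℤₚ.+-commutativeSemigroup (g x) (g y) (∑ xs g))
          (cong (λ s → g y ℤ.+ (g x ℤ.+ s)) (∑-↭ g p))
∑-↭ g (↭.trans p q) = ≡-trans (∑-↭ g p) (∑-↭ g q)

∑-map : {X Y : Set} (h : Y → X) (ys : List Y) (g : X → ℤ) → ∑ (map h ys) g ≡ ∑ ys (g ∘ h)
∑-map h [] g = refl
∑-map h (y ∷ ys) g = cong (λ s → g (h y) ℤ.+ s) (∑-map h ys g)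

∑-cong : {X : Set} (xs : List X) {g h : X → ℤ} → (∀ x → g x ≡ h x) → ∑ xs g ≡ ∑ xs h
∑-cong [] eq = refl
∑-cong (x ∷ xs) eq = cong₂ ℤ._+_ (eq x) (∑-cong xs eq)

∑-zero : {X : Set} (xs : List X) {g : X → ℤ} → All (λ x → g x ≡ 0ℤ) xs → ∑ xs g ≡ 0ℤ
∑-zero [] [] = refl
∑-zero (x ∷ xs) (gx≡0 ∷ rest) = cong₂ ℤ._+_ gx≡0 (∑-zero xs rest)

∑-scaled : {X : Set} (s : ℤ) (h : X → ℕ) (xs : List X) {g : X → ℤ} →
  All (λ x → g x ≡ s ℤ.* + h x) xs → ∑ xs g ≡ s ℤ.* + sum (map h xs)
∑-scaled s h [] [] = sym (ℤₚ.*-zeroʳ s)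
∑-scaled s h (x ∷ xs) (eq ∷ eqs) =
  ≡-trans (cong₂ ℤ._+_ eq (∑-scaled s h xs eqs)) (sym (ℤₚ.*-distribˡ-+ s (+ h x) (+ sum (map h xs))))

≤-sum-map : {X : Set} (h : X → ℕ) {x : X} {xs : List X} → x ∈ xs → h x ≤ sum (map h xs)
≤-sum-map h (here refl) = ℕₚ.m≤m+n _ _
≤-sum-map h {xs = y ∷ _} (there x∈) = ℕₚ.≤-trans (≤-sum-map h x∈) (ℕₚ.m≤n+m _ (h y))

∈⇒↭∷ : {X : Set} {x : X} {xs : List X} → x ∈ xs → ∃[ ys ] xs ↭ x ∷ ys
∈⇒↭∷ x∈xs with ys , zs , refl ← ∈-∃++ x∈xs = ys ++ zs , shift _ ys zs

if-T : ∀ {X : Set} {b} {x y : X} → T b → (if b then x else y) ≡ x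
if-T {b = true} _ = refl

if-¬T : ∀ {X : Set} {b} {x y : X} → ¬ T b → (if b then x else y) ≡ y
if-¬T {b = true} ¬t = contradiction _ ¬t
if-¬T {b = false} _ = refl

-- Triangular families of coefficient functions

module Triangular
  {A M : Set} (_≟_ : DecidableEquality A) (Admissible : A → Set)
  (_⊒_ : Rel A 0ℓ) (⊒-trans : Transitive _⊒_) (⊒-total : Total _⊒_) (_⊒?_ : Decidable _⊒_)
  (⊒-antisym : ∀ {π μ} → Admissible π → Admissible μ → π ⊒ μ → μ ⊒ π → π ≡ μ)
  (f : A → M → ℤ) (lead : A → M)
  (f-lead≢0 : ∀ {μ} → Admissible μ → f μ (lead μ) ≢ 0ℤ)
  (f-lead-vanishes : ∀ {π μ} → Admissible π → Admissible μ → ¬ π ⊒ μ → f π (lead μ) ≡ 0ℤ)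
  where

  SameSums : List A → List A → Set
  SameSums P P′ = ∀ m → ∑[ π ∈ P ] f π m ≡ ∑[ π ∈ P′ ] f π m

  ⊒-refl : ∀ x → x ⊒ x
  ⊒-refl x = Data.Sum.reduce (⊒-total x x)

  maximum : ∀ x xs → ∃[ μ ] μ ∈ x ∷ xs × All (μ ⊒_) (x ∷ xs)
  maximum x [] = x , here refl , ⊒-refl x ∷ []
  maximum x (y ∷ xs) with maximum y xs
  ... | μ , μ∈ , μ⊒ with ⊒-total x μ
  ...   | inj₁ x⊒μ = x , here refl , ⊒-refl x ∷ All.map (⊒-trans x⊒μ) μ⊒
  ...   | inj₂ μ⊒x = μ , there μ∈ , μ⊒x ∷ μ⊒

  multiplicity : A → List A → ℕ
  multiplicity μ [] = 0
  multiplicity μ (π ∷ P) with π ≟ μ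
  ... | yes _ = suc (multiplicity μ P)
  ... | no _ = multiplicity μ P

  ∈⇒multiplicity≢0 : ∀ {μ P} → μ ∈ P → multiplicity μ P ≢ 0
  ∈⇒multiplicity≢0 {μ} {π ∷ P} μ∈ with π ≟ μ | μ∈
  ... | yes _ | _ = λ ()
  ... | no π≢μ | here μ≡π = contradiction (sym μ≡π) π≢μ
  ... | no _ | there μ∈P = ∈⇒multiplicity≢0 μ∈P

  multiplicity≢0⇒∈ : ∀ {μ} P → multiplicity μ P ≢ 0 → μ ∈ P
  multiplicity≢0⇒∈ [] m≢0 = contradiction refl m≢0
  multiplicity≢0⇒∈ {μ} (π ∷ P) m≢0 with π ≟ μ
  ... | yes π≡μ = here (sym π≡μ)
  ... | no _ = there (multiplicity≢0⇒∈ P m≢0)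

  f-lead-dominated : ∀ {π μ} → Admissible π → Admissible μ → μ ⊒ π → π ≢ μ → f π (lead μ) ≡ 0ℤ
  f-lead-dominated {π} {μ} aπ aμ μ⊒π π≢μ with π ⊒? μ
  ... | yes π⊒μ = contradiction (⊒-antisym aπ aμ π⊒μ μ⊒π) π≢μ
  ... | no π⋣μ = f-lead-vanishes aπ aμ π⋣μ

  ∑-lead : ∀ {μ P} → Admissible μ → All Admissible P → All (μ ⊒_) P →
    ∑[ π ∈ P ] f π (lead μ) ≡ + multiplicity μ P ℤ.* f μ (lead μ)
  ∑-lead {μ} {[]} aμ [] [] = sym (ℤₚ.*-zeroˡ (f μ (lead μ)))
  ∑-lead {μ} {π ∷ P} aμ (aπ ∷ aP) (μ⊒π ∷ μ⊒P) with π ≟ μ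
  ... | yes refl = ≡-trans (cong (λ s → f μ (lead μ) ℤ.+ s) (∑-lead aμ aP μ⊒P))
                           (sym (ℤₚ.suc-* (+ multiplicity μ P) (f μ (lead μ))))
  ... | no π≢μ = begin
    f π (lead μ) ℤ.+ ∑[ π ∈ P ] f π (lead μ)
      ≡⟨ cong (ℤ._+ ∑[ π ∈ P ] f π (lead μ)) (f-lead-dominated aπ aμ μ⊒π π≢μ) ⟩
    0ℤ ℤ.+ ∑[ π ∈ P ] f π (lead μ)
      ≡⟨ ℤₚ.+-identityˡ _ ⟩
    ∑[ π ∈ P ] f π (lead μ)
      ≡⟨ ∑-lead aμ aP μ⊒P ⟩
    + multiplicity μ P ℤ.* f μ (lead μ) ∎
    where open ≡-Reasoning

  multiplicity-of-maximum : ∀ {μ P P′} → Admissible μ → All Admissible P → All Admissible P′ →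
    All (μ ⊒_) P → All (μ ⊒_) P′ → SameSums P P′ → multiplicity μ P ≡ multiplicity μ P′
  multiplicity-of-maximum {μ} {P} {P′} aμ aP aP′ μ⊒P μ⊒P′ same =
    ℤₚ.+-injective (ℤₚ.*-cancelʳ-≡ _ _ (f μ (lead μ)) {{ℤ.≢-nonZero (f-lead≢0 aμ)}}
      (≡-trans (sym (∑-lead aμ aP μ⊒P)) (≡-trans (same (lead μ)) (∑-lead aμ aP′ μ⊒P′))))

  ∈-resp-multiplicity : ∀ {μ P} P′ → multiplicity μ P ≡ multiplicity μ P′ → μ ∈ P → μ ∈ P′
  ∈-resp-multiplicity P′ eq μ∈P = multiplicity≢0⇒∈ P′ (∈⇒multiplicity≢0 μ∈P ∘ ≡-trans eq)

  maximum-shared : ∀ {μ} P P′ → μ ∈ P ++ P′ → All (μ ⊒_) (P ++ P′) →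
    All Admissible P → All Admissible P′ → SameSums P P′ → μ ∈ P × μ ∈ P′
  maximum-shared P P′ μ∈ μ⊒ aP aP′ same =
    [ (λ μ∈P → μ∈P , ∈-resp-multiplicity P′ equal μ∈P)
    , (λ μ∈P′ → ∈-resp-multiplicity P (sym equal) μ∈P′ , μ∈P′) ] (∈-++⁻ P μ∈)
    where
    equal = multiplicity-of-maximum (All.lookup (++⁺ aP aP′) μ∈) aP aP′ (++⁻ˡ P μ⊒) (++⁻ʳ P μ⊒) same

  SameSums-cancel : ∀ {μ P P′ R R′} → P ↭ μ ∷ R → P′ ↭ μ ∷ R′ → SameSums P P′ → SameSums R R′
  SameSums-cancel {μ} P↭ P′↭ same m = ∙-cancelˡ (f μ m) _ _
    (≡-trans (sym (∑-↭ (λ π → f π m) P↭)) (≡-trans (same m) (∑-↭ (λ π → f π m) P′↭)))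

  SameSums⇒↭ : ∀ {P P′} → All Admissible P → All Admissible P′ → SameSums P P′ → P ↭ P′
  SameSums⇒↭ {P} = go (length P) refl
    where
    go : ∀ n {P P′} → length P ≡ n → All Admissible P → All Admissible P′ → SameSums P P′ → P ↭ P′
    go n {[]} {[]} _ _ _ _ = ↭-refl
    go n {[]} {π ∷ P′} _ aP aP′ same with maximum π P′
    ... | μ , μ∈ , μ⊒ with () ← proj₁ (maximum-shared [] (π ∷ P′) μ∈ μ⊒ aP aP′ same)
    go (suc n) {π ∷ P} {P′} len aP aP′ same with maximum π (P ++ P′)
    ... | μ , μ∈ , μ⊒ with maximum-shared (π ∷ P) P′ μ∈ μ⊒ aP aP′ same
    ...   | μ∈P , μ∈P′ with ∈⇒↭∷ μ∈P | ∈⇒↭∷ μ∈P′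
    ...     | R , P↭ | R′ , P′↭ =
      ↭-trans P↭ (↭-trans (↭-prep μ R↭R′) (↭-sym P′↭))
      where
      length-R : length R ≡ n
      length-R = ℕₚ.suc-injective (≡-trans (sym (↭-length P↭)) len)
      R↭R′ : R ↭ R′
      R↭R′ = go n length-R (All.tail (All-resp-↭ P↭ aP)) (All.tail (All-resp-↭ P′↭ aP′))
                (SameSums-cancel P↭ P′↭ same)

termCoeff : ℤ × Monomial → Monomial → ℤ
termCoeff t m = if sameMonomial (proj₂ t) m then proj₁ t else 0ℤ

mulTerm : ℤ × Monomial → ℤ × Monomial → ℤ × Monomial
mulTerm s t = (proj₁ s ℤ.* proj₁ t , proj₂ s ++ proj₂ t)

coeff-++ : ∀ p q m → coeff (p ++ q) m ≡ coeff p m ℤ.+ coeff q m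
coeff-++ [] q m = sym (ℤₚ.+-identityˡ _)
coeff-++ (t ∷ p) q m =
  ≡-trans (cong (λ s → termCoeff t m ℤ.+ s) (coeff-++ p q m)) (sym (ℤₚ.+-assoc (termCoeff t m) _ _))

coeff-*P : ∀ p q m → coeff (p *P q) m ≡ ∑[ s ∈ p ] ∑[ t ∈ q ] termCoeff (mulTerm s t) m
coeff-*P [] q m = refl
coeff-*P (s ∷ p) q m =
  ≡-trans (coeff-++ (map (mulTerm s) q) (p *P q) m)
          (cong₂ ℤ._+_ (∑-map (mulTerm s) q (λ t → termCoeff t m)) (coeff-*P p q m))

*P-identityˡ : ∀ p → 1P *P p ≡ p
*P-identityˡ [] = refl
*P-identityˡ ((c , n) ∷ p) = cong₂ _∷_ (cong (_, n) (ℤₚ.*-identityˡ c)) (*P-identityˡ p)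

*P-identityʳ : ∀ p → p *P 1P ≡ p
*P-identityʳ [] = refl
*P-identityʳ ((c , n) ∷ p) =
  cong₂ _∷_ (cong₂ _,_ (ℤₚ.*-identityʳ c) (Listₚ.++-identityʳ n)) (*P-identityʳ p)

substP-++ : ∀ σ p q → substP σ (p ++ q) ≡ substP σ p ++ substP σ q
substP-++ σ [] q = refl
substP-++ σ (t ∷ p) q =
  ≡-trans (cong (_ ++_) (substP-++ σ p q)) (sym (Listₚ.++-assoc _ (substP σ p) (substP σ q)))

substP-var*var : ∀ σ a b → substP σ (var a *P var b) ≡ σ a *P σ b
substP-var*var σ a b = begin
  (1P *P (σ a *P (σ b *P 1P))) ++ [] ≡⟨ Listₚ.++-identityʳ _ ⟩
  1P *P (σ a *P (σ b *P 1P))         ≡⟨ *P-identityˡ _ ⟩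
  σ a *P (σ b *P 1P)                 ≡⟨ cong (σ a *P_) (*P-identityʳ (σ b)) ⟩
  σ a *P σ b                         ∎
  where open ≡-Reasoning

pairCoeff : Pair → Monomial → ℤ
pairCoeff (a , b) m = coeff (D• a *P D• b) m

coeff-substP-L : ∀ P m → coeff (substP D• (L P)) m ≡ ∑[ π ∈ P ] pairCoeff π m
coeff-substP-L [] m = refl
coeff-substP-L ((a , b) ∷ P) m = begin
  coeff (substP D• ((var a *P var b) ++ L P)) m
    ≡⟨ cong (λ p → coeff p m) (substP-++ D• (var a *P var b) (L P)) ⟩
  coeff (substP D• (var a *P var b) ++ substP D• (L P)) m
    ≡⟨ coeff-++ (substP D• (var a *P var b)) _ m ⟩
  coeff (substP D• (var a *P var b)) m ℤ.+ coeff (substP D• (L P)) m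
    ≡⟨ cong₂ ℤ._+_ (cong (λ p → coeff p m) (substP-var*var D• a b)) (coeff-substP-L P m) ⟩
  pairCoeff (a , b) m ℤ.+ ∑[ π ∈ P ] pairCoeff π m ∎
  where open ≡-Reasoning

z₁ : Var
z₁ = (1 , 0)

D•-monomial : ℕ → ℕ → Monomial
D•-monomial w i = (w ∸ i , 0) ∷ replicate i z₁

D•-term : Var → ℕ → ℤ × Monomial
D•-term (w , k) i = (sign i ℤ.* + (k C i) , D•-monomial w i)

powP-var : ∀ v i → powP (var v) i ≡ (+ 1 , replicate i v) ∷ []
powP-var v zero = refl
powP-var v (suc i) = cong (λ p → var v *P p) (powP-var v i)

D•-expansion : ∀ w k → D• (w , k) ≡ map (D•-term (w , k)) (upTo (suc k))
D•-expansion w k = sumP-singletons (upTo (suc k))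
  where
  summand≡ : ∀ i → const (sign i ℤ.* + (k C i)) *P (var (w ∸ i , 0) *P powP (var z₁) i)
                   ≡ D•-term (w , k) i ∷ []
  summand≡ i rewrite powP-var z₁ i = cong (λ c → (c , D•-monomial w i) ∷ []) (ℤₚ.*-identityʳ _)
  sumP-singletons : ∀ is → sumP (map (λ i → const (sign i ℤ.* + (k C i)) *P (var (w ∸ i , 0) *P powP (var z₁) i)) is)
                           ≡ map (D•-term (w , k)) is
  sumP-singletons [] = refl
  sumP-singletons (i ∷ is) = cong₂ _++_ (summand≡ i) (sumP-singletons is)

pairCoeff-expansion : ∀ w₁ k₁ w₂ k₂ m → pairCoeff ((w₁ , k₁) , (w₂ , k₂)) m ≡
  ∑[ i ∈ upTo (suc k₁) ] ∑[ j ∈ upTo (suc k₂) ] termCoeff (mulTerm (D•-term (w₁ , k₁) i) (D•-term (w₂ , k₂) j)) m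
pairCoeff-expansion w₁ k₁ w₂ k₂ m = begin
  coeff (D• (w₁ , k₁) *P D• (w₂ , k₂)) m
    ≡⟨ cong₂ (λ p q → coeff (p *P q) m) (D•-expansion w₁ k₁) (D•-expansion w₂ k₂) ⟩
  coeff (map t₁ is *P map t₂ js) m
    ≡⟨ coeff-*P (map t₁ is) (map t₂ js) m ⟩
  ∑[ s ∈ map t₁ is ] ∑[ t ∈ map t₂ js ] termCoeff (mulTerm s t) m
    ≡⟨ ∑-map t₁ is (λ s → ∑[ t ∈ map t₂ js ] termCoeff (mulTerm s t) m) ⟩
  ∑[ i ∈ is ] ∑[ t ∈ map t₂ js ] termCoeff (mulTerm (t₁ i) t) m
    ≡⟨ ∑-cong is (λ i → ∑-map t₂ js (λ t → termCoeff (mulTerm (t₁ i) t) m)) ⟩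
  ∑[ i ∈ is ] ∑[ j ∈ js ] termCoeff (mulTerm (t₁ i) (t₂ j)) m ∎
  where
  open ≡-Reasoning
  t₁ = D•-term (w₁ , k₁)
  t₂ = D•-term (w₂ , k₂)
  is = upTo (suc k₁)
  js = upTo (suc k₂)

infix 4 _≋_

_≋_ : Monomial → Monomial → Set
m ≋ m′ = ∀ v → countVar v m ≡ countVar v m′

countVar-∷-≡ : ∀ v m → countVar v (v ∷ m) ≡ suc (countVar v m)
countVar-∷-≡ v m with v ≟v v
... | yes _ = refl
... | no v≢v = contradiction refl v≢v

countVar-∷-≢ : ∀ {v u} m → v ≢ u → countVar v (u ∷ m) ≡ countVar v m
countVar-∷-≢ {v} {u} m v≢u with v ≟v u
... | yes v≡u = contradiction v≡u v≢u
... | no _ = refl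

countVar-++ : ∀ v m m′ → countVar v (m ++ m′) ≡ countVar v m + countVar v m′
countVar-++ v [] m′ = refl
countVar-++ v (u ∷ m) m′ with v ≟v u
... | yes _ = cong suc (countVar-++ v m m′)
... | no _ = countVar-++ v m m′

countVar-replicate : ∀ v i → countVar v (replicate i v) ≡ i
countVar-replicate v zero = refl
countVar-replicate v (suc i) = ≡-trans (countVar-∷-≡ v (replicate i v)) (cong suc (countVar-replicate v i))

countVar≡0⊎∈ : ∀ v m → countVar v m ≡ 0 ⊎ v ∈ m
countVar≡0⊎∈ v [] = inj₁ refl
countVar≡0⊎∈ v (u ∷ m) with v ≟v u
... | yes v≡u = inj₂ (here v≡u)
... | no _ = Data.Sum.map₂ there (countVar≡0⊎∈ v m)

allB-∈ : ∀ f m {v} → T (allB f m) → v ∈ m → T (f v)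
allB-∈ f (u ∷ m) t (here refl) = proj₁ (Equivalence.to T-∧ t)
allB-∈ f (u ∷ m) t (there v∈m) = allB-∈ f m (proj₂ (Equivalence.to (T-∧ {f u}) t)) v∈m

allB-intro : ∀ f m → (∀ v → T (f v)) → T (allB f m)
allB-intro f [] fT = _
allB-intro f (u ∷ m) fT = Equivalence.from T-∧ (fT u , allB-intro f m fT)

sameMonomial-sound : ∀ m m′ → T (sameMonomial m m′) → m ≋ m′
sameMonomial-sound m m′ t v with countVar≡0⊎∈ v m | countVar≡0⊎∈ v m′
... | inj₂ v∈m | _ = toWitness (allB-∈ _ (m ++ m′) t (∈-++⁺ˡ v∈m))
... | inj₁ _ | inj₂ v∈m′ = toWitness (allB-∈ _ (m ++ m′) t (∈-++⁺ʳ m v∈m′))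
... | inj₁ m≡0 | inj₁ m′≡0 = ≡-trans m≡0 (sym m′≡0)

sameMonomial-refl : ∀ m → T (sameMonomial m m)
sameMonomial-refl m = allB-intro _ (m ++ m) (λ v → fromWitness refl)

z₁≢heavy : ∀ {x} → 2 ≤ x → z₁ ≢ (x , 0)
z₁≢heavy (s≤s ()) refl

countVar-z₁ : ∀ w i → 2 ≤ w ∸ i → countVar z₁ (D•-monomial w i) ≡ i
countVar-z₁ w i heavy =
  ≡-trans (countVar-∷-≢ (replicate i z₁) (z₁≢heavy heavy)) (countVar-replicate z₁ i)

∈-D•-monomial : ∀ {v w i} → v ∈ D•-monomial w i → v ≡ (w ∸ i , 0) ⊎ v ≡ z₁
∈-D•-monomial (here v≡) = inj₁ v≡
∈-D•-monomial {i = i} (there v∈) = inj₂ (All.lookup (replicate⁺ {P = _≡ z₁} i refl) v∈)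

match-degree : ∀ w₁ i w₂ j W₁ W₂ K₂ → 2 ≤ w₁ ∸ i → 2 ≤ w₂ ∸ j → 2 ≤ W₁ → 2 ≤ W₂ ∸ K₂ →
  D•-monomial w₁ i ++ D•-monomial w₂ j ≋ D•-monomial W₁ 0 ++ D•-monomial W₂ K₂ → i + j ≡ K₂
match-degree w₁ i w₂ j W₁ W₂ K₂ h₁ h₂ H₁ H₂ same = begin
  i + j
    ≡⟨ sym (cong₂ _+_ (countVar-z₁ w₁ i h₁) (countVar-z₁ w₂ j h₂)) ⟩
  countVar z₁ (D•-monomial w₁ i) + countVar z₁ (D•-monomial w₂ j)
    ≡⟨ sym (countVar-++ z₁ (D•-monomial w₁ i) (D•-monomial w₂ j)) ⟩
  countVar z₁ (D•-monomial w₁ i ++ D•-monomial w₂ j)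
    ≡⟨ same z₁ ⟩
  countVar z₁ (D•-monomial W₁ 0 ++ D•-monomial W₂ K₂)
    ≡⟨ countVar-++ z₁ (D•-monomial W₁ 0) (D•-monomial W₂ K₂) ⟩
  countVar z₁ (D•-monomial W₁ 0) + countVar z₁ (D•-monomial W₂ K₂)
    ≡⟨ cong₂ _+_ (countVar-z₁ W₁ 0 H₁) (countVar-z₁ W₂ K₂ H₂) ⟩
  K₂ ∎
  where open ≡-Reasoning

heavy-∈-D•-monomial : ∀ {W w i} → 2 ≤ W → (W , 0) ∈ D•-monomial w i → W ≡ w ∸ i
heavy-∈-D•-monomial H W∈ with ∈-D•-monomial W∈
... | inj₁ W≡ = cong proj₁ W≡
... | inj₂ W≡z₁ = contradiction (sym W≡z₁) (z₁≢heavy H)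

match-heavy : ∀ w₁ i w₂ j W₁ W₂ K₂ → 2 ≤ W₁ →
  D•-monomial w₁ i ++ D•-monomial w₂ j ≋ D•-monomial W₁ 0 ++ D•-monomial W₂ K₂ →
  W₁ ≡ w₁ ∸ i ⊎ W₁ ≡ w₂ ∸ j
match-heavy w₁ i w₂ j W₁ W₂ K₂ H₁ same
  with countVar≡0⊎∈ (W₁ , 0) (D•-monomial w₁ i ++ D•-monomial w₂ j)
... | inj₁ count≡0
  with () ← ≡-trans (sym count≡0) (≡-trans (same (W₁ , 0)) (countVar-∷-≡ (W₁ , 0) (D•-monomial W₂ K₂)))
... | inj₂ W₁∈ =
  Data.Sum.map (heavy-∈-D•-monomial H₁) (heavy-∈-D•-monomial H₁) (∈-++⁻ (D•-monomial w₁ i) W₁∈)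

-- The order on strict pairs

data _⊒_ : Pair → Pair → Set where
  heavier : ∀ {w₁ k₁ w₂ k₂ W₁ K₁ W₂ K₂} → W₁ < w₁ → ((w₁ , k₁) , (w₂ , k₂)) ⊒ ((W₁ , K₁) , (W₂ , K₂))
  lighter-tail : ∀ {w k₁ w₂ k₂ K₁ W₂ K₂} → w₂ ∸ k₂ ≤ W₂ ∸ K₂ → ((w , k₁) , (w₂ , k₂)) ⊒ ((w , K₁) , (W₂ , K₂))

_⊒?_ : Decidable _⊒_
((w₁ , k₁) , (w₂ , k₂)) ⊒? ((W₁ , K₁) , (W₂ , K₂)) with W₁ ℕₚ.<? w₁ | w₁ ℕₚ.≟ W₁ | w₂ ∸ k₂ ℕₚ.≤? W₂ ∸ K₂
... | yes W₁<w₁ | _ | _ = yes (heavier W₁<w₁)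
... | no _ | yes refl | yes tail≤ = yes (lighter-tail tail≤)
... | no W₁≮w₁ | no w₁≢W₁ | _ = no λ { (heavier W₁<w₁) → W₁≮w₁ W₁<w₁ ; (lighter-tail _) → w₁≢W₁ refl }
... | no W₁≮w₁ | yes refl | no tail≰ = no λ { (heavier W₁<w₁) → W₁≮w₁ W₁<w₁ ; (lighter-tail tail≤) → tail≰ tail≤ }

⊒-trans : Transitive _⊒_
⊒-trans (heavier p) (heavier q) = heavier (ℕₚ.<-trans q p)
⊒-trans (heavier p) (lighter-tail _) = heavier p
⊒-trans (lighter-tail _) (heavier q) = heavier q
⊒-trans (lighter-tail p) (lighter-tail q) = lighter-tail (ℕₚ.≤-trans p q)

⊒-total : Total _⊒_
⊒-total ((w₁ , k₁) , (w₂ , k₂)) ((W₁ , K₁) , (W₂ , K₂)) with ℕₚ.<-cmp w₁ W₁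
... | tri< w₁<W₁ _ _ = inj₂ (heavier w₁<W₁)
... | tri> _ _ W₁<w₁ = inj₁ (heavier W₁<w₁)
... | tri≈ _ refl _ = Data.Sum.map lighter-tail lighter-tail (ℕₚ.≤-total (w₂ ∸ k₂) (W₂ ∸ K₂))

lead : Pair → Monomial
lead ((W₁ , _) , (W₂ , K₂)) = D•-monomial W₁ 0 ++ D•-monomial W₂ K₂

strict-heavy : ∀ {w k i} → suc k < w → i ≤ k → 2 ≤ w ∸ i
strict-heavy k<w i≤k = ℕₚ.m+n≤o⇒m≤o∸n 2 (ℕₚ.≤-trans (s≤s (s≤s i≤k)) k<w)

strict-≤ : ∀ {w k i} → suc k < w → i ≤ k → i ≤ w
strict-≤ k<w i≤k = ℕₚ.≤-trans i≤k (ℕₚ.≤-trans (ℕₚ.n≤1+n _) (ℕₚ.<⇒≤ k<w))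

weight-split : ∀ {w w′ i j} → i ≤ w → j ≤ w′ → (w ∸ i) + (w′ ∸ j) + (i + j) ≡ w + w′
weight-split {w} {w′} {i} {j} i≤w j≤w′ =
  ≡-trans (CommSemigroupₚ.interchange ℕₚ.+-commutativeSemigroup (w ∸ i) (w′ ∸ j) i j)
          (cong₂ _+_ (ℕₚ.m∸n+n≡m i≤w) (ℕₚ.m∸n+n≡m j≤w′))

⊒-from-first : ∀ {w₁ k₁ w₂ k₂ W₁ K₁ W₂ K₂} i {j} → i ≤ w₁ → j ≤ k₂ →
  W₁ ≡ w₁ ∸ i → w₂ ∸ j ≡ W₂ ∸ K₂ → ((w₁ , k₁) , (w₂ , k₂)) ⊒ ((W₁ , K₁) , (W₂ , K₂))
⊒-from-first zero _ j≤k₂ refl w₂∸j≡ =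
  lighter-tail (ℕₚ.≤-trans (ℕₚ.∸-monoʳ-≤ _ j≤k₂) (ℕₚ.≤-reflexive w₂∸j≡))
⊒-from-first (suc i) i≤w₁ _ refl _ = heavier (ℕₚ.∸-monoʳ-< z<s i≤w₁)

⊒-from-second : ∀ {w₁ k₁ w₂ k₂ W₁ K₁ W₂ K₂ i} j → j ≤ w₂ → i ≤ k₁ →
  w₂ < w₁ ⊎ (w₁ ≡ w₂ × k₁ ≤ k₂) →
  W₁ ≡ w₂ ∸ j → w₁ ∸ i ≡ W₂ ∸ K₂ → ((w₁ , k₁) , (w₂ , k₂)) ⊒ ((W₁ , K₁) , (W₂ , K₂))
⊒-from-second j _ _ (inj₁ w₂<w₁) refl _ = heavier (ℕₚ.≤-<-trans (ℕₚ.m∸n≤m _ j) w₂<w₁)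
⊒-from-second (suc j) j≤w₂ _ (inj₂ (refl , _)) refl _ = heavier (ℕₚ.∸-monoʳ-< z<s j≤w₂)
⊒-from-second {w₁} zero _ i≤k₁ (inj₂ (refl , k₁≤k₂)) refl w₁∸i≡ =
  lighter-tail (ℕₚ.≤-trans (ℕₚ.∸-monoʳ-≤ w₁ k₁≤k₂)
                 (ℕₚ.≤-trans (ℕₚ.∸-monoʳ-≤ w₁ i≤k₁) (ℕₚ.≤-reflexive w₁∸i≡)))

match⇒⊒ : ∀ {N d w₁ k₁ w₂ k₂ W₁ K₁ W₂ K₂ i j} →
  IsStrictPair N d ((w₁ , k₁) , (w₂ , k₂)) → IsStrictPair N d ((W₁ , K₁) , (W₂ , K₂)) →
  i ≤ k₁ → j ≤ k₂ → D•-monomial w₁ i ++ D•-monomial w₂ j ≋ lead ((W₁ , K₁) , (W₂ , K₂)) →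
  ((w₁ , k₁) , (w₂ , k₂)) ⊒ ((W₁ , K₁) , (W₂ , K₂))
match⇒⊒ {N} {d} {w₁} {k₁} {w₂} {k₂} {W₁} {K₁} {W₂} {K₂} {i} {j}
  ((_ , k₁<w₁) , (_ , k₂<w₂) , w≡N , _ , canonical) ((_ , K₁<W₁) , (_ , K₂<W₂) , W≡N , _ , _)
  i≤k₁ j≤k₂ same =
  [ (λ W₁≡ → ⊒-from-first i i≤w₁ j≤k₂ W₁≡
               (ℕₚ.+-cancelˡ-≡ W₁ _ _ (≡-trans (cong (_+ (w₂ ∸ j)) W₁≡) light-sum)))
  , (λ W₁≡ → ⊒-from-second j j≤w₂ i≤k₁ canonical W₁≡
               (ℕₚ.+-cancelʳ-≡ W₁ _ _ (≡-trans (cong (λ n → (w₁ ∸ i) + n) W₁≡)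
                                               (≡-trans light-sum (ℕₚ.+-comm W₁ _))))) ]
  (match-heavy w₁ i w₂ j W₁ W₂ K₂ H₁ same)
  where
  open ≡-Reasoning
  H₁ = strict-heavy K₁<W₁ z≤n
  i≤w₁ = strict-≤ k₁<w₁ i≤k₁
  j≤w₂ = strict-≤ k₂<w₂ j≤k₂
  degree : i + j ≡ K₂
  degree = match-degree w₁ i w₂ j W₁ W₂ K₂ (strict-heavy k₁<w₁ i≤k₁) (strict-heavy k₂<w₂ j≤k₂) H₁
                        (strict-heavy K₂<W₂ ℕₚ.≤-refl) same
  light-sum : (w₁ ∸ i) + (w₂ ∸ j) ≡ W₁ + (W₂ ∸ K₂)
  light-sum = ℕₚ.+-cancelʳ-≡ K₂ _ _ (begin
    (w₁ ∸ i) + (w₂ ∸ j) + K₂       ≡⟨ cong (λ n → (w₁ ∸ i) + (w₂ ∸ j) + n) (sym degree) ⟩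
    (w₁ ∸ i) + (w₂ ∸ j) + (i + j)  ≡⟨ weight-split i≤w₁ j≤w₂ ⟩
    w₁ + w₂                        ≡⟨ ≡-trans w≡N (sym W≡N) ⟩
    W₁ + W₂                        ≡⟨ sym (weight-split z≤n (strict-≤ K₂<W₂ ℕₚ.≤-refl)) ⟩
    W₁ + (W₂ ∸ K₂) + K₂            ∎)

⊒-antisym : ∀ {N d π μ} → IsStrictPair N d π → IsStrictPair N d μ → π ⊒ μ → μ ⊒ π → π ≡ μ
⊒-antisym _ _ (heavier W₁<w₁) (heavier w₁<W₁) = contradiction W₁<w₁ (ℕₚ.<-asym w₁<W₁)
⊒-antisym _ _ (heavier w<w) (lighter-tail _) = contradiction w<w (ℕₚ.<-irrefl refl)
⊒-antisym _ _ (lighter-tail _) (heavier w<w) = contradiction w<w (ℕₚ.<-irrefl refl)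
⊒-antisym {π = (w₁ , k₁) , (w₂ , k₂)} {μ = (.w₁ , K₁) , (W₂ , K₂)}
  (_ , (_ , k₂<w₂) , w≡N , k≡d , _) (_ , (_ , K₂<W₂) , W≡N , K≡d , _) (lighter-tail ≤₁) (lighter-tail ≤₂)
  with refl ← ℕₚ.+-cancelˡ-≡ w₁ w₂ W₂ (≡-trans w≡N (sym W≡N))
  with refl ← ℕₚ.∸-cancelˡ-≡ (strict-≤ k₂<w₂ ℕₚ.≤-refl) (strict-≤ K₂<W₂ ℕₚ.≤-refl) (ℕₚ.≤-antisym ≤₁ ≤₂)
  with refl ← ℕₚ.+-cancelʳ-≡ k₂ k₁ K₁ (ℕₚ.+-cancelʳ-≡ 1 (k₁ + k₂) (K₁ + k₂) (≡-trans k≡d (sym K≡d)))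
  = refl

pairCoeff-lead-vanishes : ∀ {N d π μ} → IsStrictPair N d π → IsStrictPair N d μ → ¬ π ⊒ μ →
  pairCoeff π (lead μ) ≡ 0ℤ
pairCoeff-lead-vanishes {π = (w₁ , k₁) , (w₂ , k₂)} {μ} sπ sμ π⋣μ =
  ≡-trans (pairCoeff-expansion w₁ k₁ w₂ k₂ (lead μ))
    (∑-zero (upTo (suc k₁)) (All.map (λ i<k₁ → ∑-zero (upTo (suc k₂)) (All.map (term i<k₁) (all-upTo _)))
                                     (all-upTo _)))
  where
  term : ∀ {i j} → i < suc k₁ → j < suc k₂ →
    termCoeff (mulTerm (D•-term (w₁ , k₁) i) (D•-term (w₂ , k₂) j)) (lead μ) ≡ 0ℤ
  term {i} {j} (s≤s i≤k₁) (s≤s j≤k₂) with T? (sameMonomial (D•-monomial w₁ i ++ D•-monomial w₂ j) (lead μ))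
  ... | yes t = contradiction (match⇒⊒ sπ sμ i≤k₁ j≤k₂ (sameMonomial-sound (D•-monomial w₁ i ++ D•-monomial w₂ j) (lead μ) t))
                              π⋣μ
  ... | no ¬t = if-¬T ¬t

sign-+ : ∀ i j → sign (i + j) ≡ sign i ℤ.* sign j
sign-+ zero j = sym (ℤₚ.*-identityˡ (sign j))
sign-+ (suc i) j = ≡-trans (cong -_ (sign-+ i j)) (ℤₚ.neg-distribˡ-* (sign i) (sign j))

sign≢0 : ∀ i → sign i ≢ 0ℤ
sign≢0 zero ()
sign≢0 (suc i) eq = sign≢0 i (ℤₚ.neg-injective eq)

sign*pos≢0 : ∀ k {n} → 1 ≤ n → sign k ℤ.* + n ≢ 0ℤ
sign*pos≢0 k {suc n} _ eq with ℤₚ.i*j≡0⇒i≡0∨j≡0 (sign k) eq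
... | inj₁ sign≡0 = sign≢0 k sign≡0

signed-* : ∀ i j a b → (sign i ℤ.* + a) ℤ.* (sign j ℤ.* + b) ≡ sign (i + j) ℤ.* + (a ℕ.* b)
signed-* i j a b =
  ≡-trans (CommSemigroupₚ.interchange ℤₚ.*-commutativeSemigroup (sign i) (+ a) (sign j) (+ b))
          (cong₂ ℤ._*_ (sym (sign-+ i j)) (sym (ℤₚ.pos-* a b)))

leadCount : Pair → ℕ → ℕ → ℕ
leadCount μ@((W₁ , K₁) , (W₂ , K₂)) i j =
  if sameMonomial (D•-monomial W₁ i ++ D•-monomial W₂ j) (lead μ) then (K₁ C i) ℕ.* (K₂ C j) else 0

own-lead-term : ∀ {N d W₁ K₁ W₂ K₂ i j} → IsStrictPair N d ((W₁ , K₁) , (W₂ , K₂)) → i < suc K₁ → j < suc K₂ →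
  termCoeff (mulTerm (D•-term (W₁ , K₁) i) (D•-term (W₂ , K₂) j)) (lead ((W₁ , K₁) , (W₂ , K₂)))
    ≡ sign K₂ ℤ.* + leadCount ((W₁ , K₁) , (W₂ , K₂)) i j
own-lead-term {W₁ = W₁} {K₁} {W₂} {K₂} {i} {j} ((_ , K₁<W₁) , (_ , K₂<W₂) , _) (s≤s i≤K₁) (s≤s j≤K₂)
  with T? (sameMonomial (D•-monomial W₁ i ++ D•-monomial W₂ j) (lead ((W₁ , K₁) , (W₂ , K₂))))
... | yes t = begin
  termCoeff (mulTerm (D•-term (W₁ , K₁) i) (D•-term (W₂ , K₂) j)) (lead ((W₁ , K₁) , (W₂ , K₂)))
    ≡⟨ if-T t ⟩
  (sign i ℤ.* + (K₁ C i)) ℤ.* (sign j ℤ.* + (K₂ C j))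
    ≡⟨ signed-* i j _ _ ⟩
  sign (i + j) ℤ.* + ((K₁ C i) ℕ.* (K₂ C j))
    ≡⟨ cong (λ k → sign k ℤ.* + ((K₁ C i) ℕ.* (K₂ C j))) degree ⟩
  sign K₂ ℤ.* + ((K₁ C i) ℕ.* (K₂ C j))
    ≡⟨ cong (λ n → sign K₂ ℤ.* + n) (if-T t) ⟨
  sign K₂ ℤ.* + leadCount ((W₁ , K₁) , (W₂ , K₂)) i j ∎
  where
  open ≡-Reasoning
  degree : i + j ≡ K₂
  degree = match-degree W₁ i W₂ j W₁ W₂ K₂ (strict-heavy K₁<W₁ i≤K₁) (strict-heavy K₂<W₂ j≤K₂)
             (strict-heavy K₁<W₁ z≤n) (strict-heavy K₂<W₂ ℕₚ.≤-refl)
             (sameMonomial-sound (D•-monomial W₁ i ++ D•-monomial W₂ j) _ t)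
... | no ¬t = begin
  termCoeff (mulTerm (D•-term (W₁ , K₁) i) (D•-term (W₂ , K₂) j)) (lead ((W₁ , K₁) , (W₂ , K₂)))
    ≡⟨ if-¬T ¬t ⟩
  0ℤ
    ≡⟨ ℤₚ.*-zeroʳ (sign K₂) ⟨
  sign K₂ ℤ.* 0ℤ
    ≡⟨ cong (λ n → sign K₂ ℤ.* + n) (if-¬T ¬t) ⟨
  sign K₂ ℤ.* + leadCount ((W₁ , K₁) , (W₂ , K₂)) i j ∎
  where open ≡-Reasoning

pairCoeff-lead≢0 : ∀ {N d μ} → IsStrictPair N d μ → pairCoeff μ (lead μ) ≢ 0ℤ
pairCoeff-lead≢0 {μ = μ@((W₁ , K₁) , (W₂ , K₂))} sμ =
  subst (_≢ 0ℤ) (sym expansion) (sign*pos≢0 K₂ total≥1)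
  where
  row : ℕ → ℕ
  row i = sum (map (leadCount μ i) (upTo (suc K₂)))
  total = sum (map row (upTo (suc K₁)))
  expansion : pairCoeff μ (lead μ) ≡ sign K₂ ℤ.* + total
  expansion = ≡-trans (pairCoeff-expansion W₁ K₁ W₂ K₂ (lead μ))
    (∑-scaled (sign K₂) row (upTo (suc K₁))
      (All.map (λ i<K₁ → ∑-scaled (sign K₂) _ (upTo (suc K₂)) (All.map (own-lead-term sμ i<K₁) (all-upTo _)))
               (all-upTo _)))
  diagonal : leadCount μ 0 K₂ ≡ 1
  diagonal = ≡-trans (if-T (sameMonomial-refl (lead μ))) (cong (1 ℕ.*_) (nCn≡1 K₂))
  total≥1 : 1 ≤ total
  total≥1 = ℕₚ.≤-trans (ℕₚ.≤-reflexive (sym diagonal))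
    (ℕₚ.≤-trans (≤-sum-map (leadCount μ 0) (∈-upTo⁺ (ℕₚ.n<1+n K₂))) (≤-sum-map row (∈-upTo⁺ {n = suc K₁} z<s)))

lemma7p13 : (N d : ℕ) (P P′ : List Pair) →
    All (IsStrictPair N d) P → All (IsStrictPair N d) P′ →
    substP D• (L P) ≈P substP D• (L P′) →
    P ↭ P′
lemma7p13 N d P P′ sP sP′ eq = SameSums⇒↭ sP sP′ same
  where
  open Triangular (≡-dec _≟v_ _≟v_) (IsStrictPair N d) _⊒_ ⊒-trans ⊒-total _⊒?_ ⊒-antisym
    pairCoeff lead pairCoeff-lead≢0 pairCoeff-lead-vanishes
  same : SameSums P P′
  same m = ≡-trans (sym (coeff-substP-L P m)) (≡-trans (eq m) (coeff-substP-L P′ m))
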